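{- Let $q\ge 2$, $m,s,v\ge 1$, $t\ge 2$ be integers. (1) If $q<m\le 2q$ and $2\le s\le 3$, then $K_{2q}^{RT}(2m,s,2ms-3)\le q\,\big(OCAN(3,m,s,2)+CAN(2,m,2)\big)$. (2) If $(t-1)q+1\le m\le (t-1)qv$, then $K_{qv}^{RT}(m,s,ms-t)\le q\,OCAN(t,m,s,v)$.
   Context: For positive integers $m,s$, the RT poset $[m\times s]$ is $\{1,\dots,ms\}$ partitioned into blocks $B_i=\{is+1,\dots,(i+1)s\}$, $i=0,\dots,m-1$, each a chain $is+1\prec\cdots\prec(i+1)s$, with elements of different blocks incomparable. An ideal is a down-closed subset; an anti-ideal is the complement of an ideal; $\langle A\rangle$ is the smallest ideal containing $A$. For an integer $q\ge 2$, the RT distance on $\mathbb{Z}_q^{ms}$ is $d_{RT}(x,y)=|\langle\{i:x_i\ne y_i\}\rangle|$. A code $C\subseteq\mathbb{Z}_q^{ms}$ is an $R$-covering if every $x$ has some $c\in C$ with $d_{RT}(x,c)\le R$; $K_q^{RT}(m,s,R)$ is the minimum size of an $R$-covering. For positive integers $t,m,s,v,N$ with $2\le t\le ms$, an $OCA(N;t,m,s,v)$ is an $N\times ms$ array over an alphabet of size $v$ with columns labeled by the elements of $[m\times s]$ such that for every anti-ideal $J$ with $|J|=t$, the columns labeled by $J$ contain every $t$-tuple over the alphabet as a row at least once; $OCAN(t,m,s,v)$ is the smallest such $N$. A covering array $CA(N;t,n,v)$ is an $N\times n$ array over an alphabet of size $v$ ($2\le t\le n$) in which every set of $t$ columns contains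 every $t$-tuple as a row; $CAN(t,n,v)$ is the smallest such $N$. -}

module Defs where

open import Data.Nat using (ℕ; zero; suc; _+_; _*_; _≤_)
import Data.Fin as Fin
open import Data.Fin using (Fin) renaming (_≤_ to _≤ᶠ_)
open import Data.Fin.Subset using (Subset; _∈_; ∣_∣)
open import Data.Bool using (Bool; true; false; if_then_else_)
open import Data.List using (List; length)
open import Data.List.Membership.Propositional using () renaming (_∈_ to _∈ₗ_)
open import Data.Product using (Σ; ∃; _×_)
open import Relation.Binary.PropositionalEquality using (_≡_; _≢_)

sumFin : (n : ℕ) → (Fin n → ℕ) → ℕ
sumFin zero    f = 0
sumFin (suc n) f = f Fin.zero + sumFin n (λ i → f (Fin.suc i))

-- The RT poset [m × s]: element (i , j) = position j (0-based) of block i;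
-- (i , j) ≺ (i , k) iff j < k; different blocks incomparable.
PSet : ℕ → ℕ → Set
PSet m s = Fin m → Fin s → Bool

card : ∀ {m s} → PSet m s → ℕ
card {m} {s} P = sumFin m (λ i → sumFin s (λ j → if P i j then 1 else 0))

IsIdeal : ∀ {m s} → PSet m s → Set
IsIdeal {m} {s} I = ∀ (i : Fin m) (j k : Fin s) → I i j ≡ true → k ≤ᶠ j → I i k ≡ true

IsAntiIdeal : ∀ {m s} → PSet m s → Set
IsAntiIdeal {m} {s} J = Σ (PSet m s) λ I → IsIdeal I × (∀ i j → J i j ≡ (if I i j then false else true))

_⊆ₚ_ : ∀ {m s} → PSet m s → PSet m s → Set
_⊆ₚ_ {m} {s} A B = ∀ i j → A i j ≡ true → B i j ≡ true

Word : ℕ → ℕ → ℕ → Set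
Word q m s = Fin m → Fin s → Fin q

-- d_RT(x , y) ≤ R  :⇔  |⟨{ i : x_i ≠ y_i }⟩| ≤ R.  Since ⟨A⟩ is the smallest
-- ideal containing A, this holds iff some ideal containing the support has
-- at most R elements.
dRT≤ : ∀ {q m s} → Word q m s → Word q m s → ℕ → Set
dRT≤ {q} {m} {s} x y R =
  Σ (PSet m s) λ I → IsIdeal I × (∀ i j → x i j ≢ y i j → I i j ≡ true) × card I ≤ R

IsCovering : (q m s R : ℕ) → List (Word q m s) → Set
IsCovering q m s R C = ∀ (x : Word q m s) → ∃ λ c → c ∈ₗ C × dRT≤ x c R

IsMin : (ℕ → Set) → ℕ → Set
IsMin P n = P n × (∀ k → P k → n ≤ k)

IsK : (q m s R : ℕ) → ℕ → Set
IsK q m s R = IsMin (λ k → Σ (List (Word q m s)) λ C → length C ≡ k × IsCovering q m s R C)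

IsOCA : (N t m s v : ℕ) → (Fin N → Word v m s) → Set
IsOCA N t m s v A =
  ∀ (J : PSet m s) → IsAntiIdeal J → card J ≡ t →
  ∀ (f : Word v m s) → ∃ λ (r : Fin N) → ∀ i j → J i j ≡ true → A r i j ≡ f i j

IsOCAN : (t m s v : ℕ) → ℕ → Set
IsOCAN t m s v = IsMin (λ N → Σ (Fin N → Word v m s) (IsOCA N t m s v))

IsCA : (N t n v : ℕ) → (Fin N → Fin n → Fin v) → Set
IsCA N t n v A =
  ∀ (S : Subset n) → ∣ S ∣ ≡ t →
  ∀ (f : Fin n → Fin v) → ∃ λ (r : Fin N) → ∀ c → c ∈ S → A r c ≡ f c

IsCAN : (t n v : ℕ) → ℕ → Set
IsCAN t n v = IsMin (λ N → Σ (Fin N → Fin n → Fin v) (IsCA N t n v))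

-- The top elements of any t blocks of [m × s] form an anti-ideal, so the top entries of an
-- OCA(N; t, m, s, v) form a CA(N; t, m, v) T.  Identify Z_qv with Z_q × Z_v and take the q N
-- words whose i-th block is constantly (a , T r i).  Given x, look at the Z_q-parts of its top
-- entries: as m > (t - 1) q, some t blocks share the same part a, and some row r of T matches
-- the Z_v-parts there.  So x agrees with the word of (a , r) on the tops of these t blocks, an
-- anti-ideal of size t, whence d_RT ≤ ms - t.  This is (2).
-- For (1), write Z_2q = Z_2 × Z_q and let T be the doubling of the top entries A of the OCA and
-- of the CA B, a CA(O + C; 3, 2m, 2): column (h , i) reads A r i in the first O rows and
-- h ⊕ B r i in the last C rows.  If a target on three columns factors through i, a row of A
-- realizes it; otherwise two of the columns are (0 , i) and (1 , i) with different values, so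
-- h ⊕ target (h , i) does not depend on h at i, and a row of B realizes it.

module Submission where

open import Data.Bool using (Bool; true; false; if_then_else_; _∧_; not)
open import Data.Fin using (Fin; zero; suc; fromℕ; combine; remQuot; splitAt; _↑ˡ_; _↑ʳ_)
  renaming (_≤_ to _≤ᶠ_)
open import Data.Fin.Properties
  using (_≟_; any?; ≤fromℕ; remQuot-combine; combine-remQuot; splitAt-↑ˡ; splitAt-↑ʳ)
  renaming (≤-antisym to ≤ᶠ-antisym)
open import Data.Fin.Subset using (Subset; _∈_; _⊆_; ∣_∣; ⊥; ⊤; ⁅_⁆; _∪_; inside; outside)
open import Data.Fin.Subset.Properties
  using (⊥⊆; ⊆⊤; ∣⊥∣≡0; ∣⊤∣≡n; in⊆in; s⊆s; out⊆; drop-∷-⊆; ∣p∣≤∣x∷p∣; ∣⁅x⁆∣≡1; x∈⁅x⁆; x∈p∪q⁺)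
open import Data.List as List using (List; length)
open import Data.List.Properties using (length-tabulate)
open import Data.List.Membership.Propositional using () renaming (_∈_ to _∈ₗ_)
open import Data.List.Membership.Propositional.Properties using (∈-tabulate⁺)
open import Data.Nat using (ℕ; zero; suc; _+_; _*_; _∸_; _≤_; _<_; z≤n; s≤s; _≤?_; _<?_)
open import Data.Nat.Properties hiding (_≟_)
open import Algebra.Properties.CommutativeSemigroup +-commutativeSemigroup using (interchange)
open import Data.Product using (_×_; ∃; ∃₂; _,_; proj₁; proj₂; uncurry; swap)
open import Data.Sum using (_⊎_; inj₁; inj₂; [_,_])
open import Data.Vec as Vec using (Vec; []; _∷_; lookup; tabulate; here; there)
open import Data.Vec.Properties using (lookup⇒[]=; []=⇒lookup; lookup∘tabulate)
open import Data.Vec.Relation.Unary.All as All using (All; []; _∷_)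
open import Data.Vec.Relation.Unary.All.Properties using (map⁻)
open import Data.Vec.Relation.Unary.Any using (here; there)
open import Data.Vec.Membership.Propositional using () renaming (_∈_ to _∈ᵥ_)
open import Data.Vec.Membership.Propositional.Properties using (∈-map⁺)
open import Function using (_∘_; _$_)
open import Relation.Nullary using (yes; no; does; contradiction)
open import Relation.Nullary.Decidable using (dec-true)
open import Relation.Binary.PropositionalEquality
  using (_≡_; _≢_; refl; sym; trans; cong; cong₂; subst; module ≡-Reasoning)

open import Defs

ind : Bool → ℕ
ind b = if b then 1 else 0

sumFin-cong : ∀ n {f g : Fin n → ℕ} → (∀ i → f i ≡ g i) → sumFin n f ≡ sumFin n g
sumFin-cong zero    f≗g = refl
sumFin-cong (suc n) f≗g = cong₂ _+_ (f≗g zero) (sumFin-cong n (f≗g ∘ suc))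

sumFin-distrib-+ : ∀ n (f g : Fin n → ℕ) →
  sumFin n (λ i → f i + g i) ≡ sumFin n f + sumFin n g
sumFin-distrib-+ zero    f g = refl
sumFin-distrib-+ (suc n) f g =
  trans (cong (f zero + g zero +_) (sumFin-distrib-+ n (f ∘ suc) (g ∘ suc)))
        (interchange (f zero) (g zero) _ _)

sumFin-const : ∀ n c → sumFin n (λ _ → c) ≡ n * c
sumFin-const zero    c = refl
sumFin-const (suc n) c = cong (c +_) (sumFin-const n c)

sumFin-zero : ∀ n → sumFin n (λ _ → 0) ≡ 0
sumFin-zero n = trans (sumFin-const n 0) (*-zeroʳ n)

sumFin-comm : ∀ m n (f : Fin m → Fin n → ℕ) →
  sumFin m (λ i → sumFin n (f i)) ≡ sumFin n (λ j → sumFin m (λ i → f i j))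
sumFin-comm zero    n f = sym (sumFin-zero n)
sumFin-comm (suc m) n f =
  trans (cong (sumFin n (f zero) +_) (sumFin-comm m n (f ∘ suc)))
        (sym (sumFin-distrib-+ n (f zero) _))

sumFin-mono-≤ : ∀ n {f g : Fin n → ℕ} → (∀ i → f i ≤ g i) → sumFin n f ≤ sumFin n g
sumFin-mono-≤ zero    f≤g = z≤n
sumFin-mono-≤ (suc n) f≤g = +-mono-≤ (f≤g zero) (sumFin-mono-≤ n (f≤g ∘ suc))

sumFin-ind-≟ : ∀ {n} (x : Fin n) → sumFin n (λ y → ind (does (x ≟ y))) ≡ 1
sumFin-ind-≟ {suc n} zero    = cong suc (sumFin-zero n)
sumFin-ind-≟ {suc n} (suc x) = sumFin-ind-≟ x

∣p∣≡sumFin : ∀ {n} (p : Subset n) → ∣ p ∣ ≡ sumFin n (λ i → ind (lookup p i))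
∣p∣≡sumFin []            = refl
∣p∣≡sumFin (inside ∷ p)  = cong suc (∣p∣≡sumFin p)
∣p∣≡sumFin (outside ∷ p) = ∣p∣≡sumFin p

∣p∪q∣≤∣p∣+∣q∣ : ∀ {n} (p q : Subset n) → ∣ p ∪ q ∣ ≤ ∣ p ∣ + ∣ q ∣
∣p∪q∣≤∣p∣+∣q∣ []            []            = z≤n
∣p∪q∣≤∣p∣+∣q∣ (inside ∷ p)  (y ∷ q)       =
  s≤s (≤-trans (∣p∪q∣≤∣p∣+∣q∣ p q) (+-monoʳ-≤ ∣ p ∣ (∣p∣≤∣x∷p∣ y q)))
∣p∪q∣≤∣p∣+∣q∣ (outside ∷ p) (inside ∷ q)  =
  ≤-trans (s≤s (∣p∪q∣≤∣p∣+∣q∣ p q)) (≤-reflexive (sym (+-suc ∣ p ∣ ∣ q ∣)))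
∣p∪q∣≤∣p∣+∣q∣ (outside ∷ p) (outside ∷ q) = ∣p∪q∣≤∣p∣+∣q∣ p q

⊆-sized-between : ∀ {n} (p r : Subset n) t → p ⊆ r → ∣ p ∣ ≤ t → t ≤ ∣ r ∣ →
  ∃ λ q → p ⊆ q × q ⊆ r × ∣ q ∣ ≡ t
⊆-sized-between []            []           t       _   _       t≤0 =
  [] , (λ ()) , (λ ()) , sym (n≤0⇒n≡0 t≤0)
⊆-sized-between (inside ∷ p)  (outside ∷ r) t      p⊆r _       _   with () ← p⊆r here
⊆-sized-between (inside ∷ p)  (inside ∷ r) (suc t) p⊆r (s≤s ∣p∣≤t) (s≤s t≤∣r∣)
  with q , p⊆q , q⊆r , ∣q∣≡t ← ⊆-sized-between p r t (drop-∷-⊆ p⊆r) ∣p∣≤t t≤∣r∣ =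
  inside ∷ q , in⊆in p⊆q , in⊆in q⊆r , cong suc ∣q∣≡t
⊆-sized-between (outside ∷ p) (outside ∷ r) t      p⊆r ∣p∣≤t t≤∣r∣
  with q , p⊆q , q⊆r , ∣q∣≡t ← ⊆-sized-between p r t (drop-∷-⊆ p⊆r) ∣p∣≤t t≤∣r∣ =
  outside ∷ q , s⊆s p⊆q , s⊆s q⊆r , ∣q∣≡t
⊆-sized-between (outside ∷ p) (inside ∷ r) t       p⊆r ∣p∣≤t t≤1+∣r∣ with t ≤? ∣ r ∣
... | yes t≤∣r∣ with q , p⊆q , q⊆r , ∣q∣≡t ← ⊆-sized-between p r t (drop-∷-⊆ p⊆r) ∣p∣≤t t≤∣r∣ =
  outside ∷ q , s⊆s p⊆q , out⊆ q⊆r , ∣q∣≡t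
... | no t≰∣r∣ = inside ∷ r , out⊆ (drop-∷-⊆ p⊆r) , (λ x∈r → x∈r) , ≤-antisym (≰⇒> t≰∣r∣) t≤1+∣r∣

enumerate : ∀ {n} (p : Subset n) → ∃ λ (xs : Vec (Fin n) ∣ p ∣) → ∀ {x} → x ∈ p → x ∈ᵥ xs
enumerate []            = [] , λ ()
enumerate (inside ∷ p)  with xs , complete ← enumerate p =
  zero ∷ Vec.map suc xs , λ { here → here refl ; (there x∈p) → there (∈-map⁺ suc (complete x∈p)) }
enumerate (outside ∷ p) with xs , complete ← enumerate p =
  Vec.map suc xs , λ { (there x∈p) → ∈-map⁺ suc (complete x∈p) }

image : ∀ {n k} → Vec (Fin n) k → Subset n
image []       = ⊥
image (x ∷ xs) = ⁅ x ⁆ ∪ image xs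

∣image∣≤length : ∀ {n k} (xs : Vec (Fin n) k) → ∣ image xs ∣ ≤ k
∣image∣≤length {n} []       = ≤-reflexive (∣⊥∣≡0 n)
∣image∣≤length (x ∷ xs) = begin
  ∣ ⁅ x ⁆ ∪ image xs ∣       ≤⟨ ∣p∪q∣≤∣p∣+∣q∣ ⁅ x ⁆ (image xs) ⟩
  ∣ ⁅ x ⁆ ∣ + ∣ image xs ∣   ≡⟨ cong (_+ ∣ image xs ∣) (∣⁅x⁆∣≡1 x) ⟩
  suc ∣ image xs ∣           ≤⟨ s≤s (∣image∣≤length xs) ⟩
  suc _                      ∎
  where open ≤-Reasoning

∈-image : ∀ {n k} (xs : Vec (Fin n) k) → All (_∈ image xs) xs
∈-image []       = []
∈-image (x ∷ xs) = x∈p∪q⁺ (inj₁ (x∈⁅x⁆ x)) ∷ All.map (x∈p∪q⁺ ∘ inj₂) (∈-image xs)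

fiber : ∀ {n q} → (Fin n → Fin q) → Fin q → Subset n
fiber g a = tabulate (λ i → does (g i ≟ a))

∈-fiber⁻ : ∀ {n q} (g : Fin n → Fin q) {a i} → i ∈ fiber g a → g i ≡ a
∈-fiber⁻ g {a} {i} i∈fiber with g i ≟ a | trans (sym (lookup∘tabulate _ i)) ([]=⇒lookup i∈fiber)
... | yes gi≡a | _  = gi≡a
... | no _     | ()

sumFin-∣fiber∣ : ∀ {n q} (g : Fin n → Fin q) → sumFin q (λ a → ∣ fiber g a ∣) ≡ n
sumFin-∣fiber∣ {n} {q} g = begin
  sumFin q (λ a → ∣ fiber g a ∣)
    ≡⟨ sumFin-cong q (λ a → trans (∣p∣≡sumFin (fiber g a))
                                  (sumFin-cong n (cong ind ∘ lookup∘tabulate _))) ⟩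
  sumFin q (λ a → sumFin n (λ i → ind (does (g i ≟ a))))
    ≡⟨ sumFin-comm q n _ ⟩
  sumFin n (λ i → sumFin q (λ a → ind (does (g i ≟ a))))
    ≡⟨ sumFin-cong n (sumFin-ind-≟ ∘ g) ⟩
  sumFin n (λ _ → 1)
    ≡⟨ sumFin-const n 1 ⟩
  n * 1
    ≡⟨ *-identityʳ n ⟩
  n ∎
  where open ≡-Reasoning

large-fiber : ∀ {n q} u (g : Fin n → Fin q) → u * q < n → ∃ λ a → u < ∣ fiber g a ∣
large-fiber {n} {q} u g u*q<n with any? (λ a → u <? ∣ fiber g a ∣)
... | yes found = found
... | no none = contradiction u*q<n (≤⇒≯ n≤u*q)
  where
  open ≤-Reasoning
  n≤u*q : n ≤ u * q
  n≤u*q = begin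
    n                              ≡⟨ sumFin-∣fiber∣ g ⟨
    sumFin q (λ a → ∣ fiber g a ∣) ≤⟨ sumFin-mono-≤ q (λ a → ≮⇒≥ (none ∘ (a ,_))) ⟩
    sumFin q (λ _ → u)             ≡⟨ sumFin-const q u ⟩
    q * u                          ≡⟨ *-comm q u ⟩
    u * q                          ∎

monochromatic-subset : ∀ {n q} u (g : Fin n → Fin q) → u * q < n →
  ∃₂ λ a S → ∣ S ∣ ≡ suc u × (∀ {i} → i ∈ S → g i ≡ a)
monochromatic-subset {n} u g u*q<n
  with a , u<∣fiber∣ ← large-fiber u g u*q<n
  with S , _ , S⊆fiber , ∣S∣≡1+u ← ⊆-sized-between ⊥ (fiber g a) (suc u) ⊥⊆
                                      (≤-trans (≤-reflexive (∣⊥∣≡0 n)) z≤n) u<∣fiber∣ =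
  a , S , ∣S∣≡1+u , ∈-fiber⁻ g ∘ S⊆fiber

-- Unlike in IsCA the t columns may repeat, so arbitrary triples of columns can be handled.
Covers : ∀ {N v} {X : Set} → ℕ → (Fin N → X → Fin v) → Set
Covers {N} {v} {X} t T = ∀ (f : X → Fin v) (xs : Vec X t) → ∃ λ r → All (λ x → T r x ≡ f x) xs

isCA⇒covers : ∀ {N t n v} {T : Fin N → Fin n → Fin v} → t ≤ n → IsCA N t n v T → Covers t T
isCA⇒covers {t = t} {n} t≤n ca f xs
  with S , image⊆S , _ , ∣S∣≡t ← ⊆-sized-between (image xs) ⊤ t ⊆⊤ (∣image∣≤length xs)
                                    (≤-trans t≤n (≤-reflexive (sym (∣⊤∣≡n n))))
  with r , agree ← ca S ∣S∣≡t f =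
  r , All.map (agree _ ∘ image⊆S) (∈-image xs)

covers⇒isCA : ∀ {N t n v} {T : Fin N → Fin n → Fin v} → Covers t T → IsCA N t n v T
covers⇒isCA cov S refl f
  with xs , complete ← enumerate S
  with r , agree ← cov f xs =
  r , λ c c∈S → All.lookup agree (complete c∈S)

covers-reindex : ∀ {N v t} {X Y : Set} {T : Fin N → X → Fin v} (π : Y → X) (σ : X → Y) →
  (∀ y → σ (π y) ≡ y) → Covers t T → Covers t (λ r → T r ∘ π)
covers-reindex π σ σ∘π≗id cov f ys with r , agree ← cov (f ∘ σ) (Vec.map π ys) =
  r , All.map (λ {y} e → trans e (cong f (σ∘π≗id y))) (map⁻ agree)

ind-if-not : ∀ b → ind b + ind (if b then false else true) ≡ 1
ind-if-not true  = refl
ind-if-not false = refl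

card-complement : ∀ {m s} (I J : PSet m s) → (∀ i j → J i j ≡ (if I i j then false else true)) →
  card I + card J ≡ m * s
card-complement {m} {s} I J J≡∁I = begin
  card I + card J
    ≡⟨ sumFin-distrib-+ m _ _ ⟨
  sumFin m (λ i → sumFin s (λ j → ind (I i j)) + sumFin s (λ j → ind (J i j)))
    ≡⟨ sumFin-cong m (λ i → sumFin-distrib-+ s _ _) ⟨
  sumFin m (λ i → sumFin s (λ j → ind (I i j) + ind (J i j)))
    ≡⟨ sumFin-cong m (λ i → sumFin-cong s (λ j → trans (cong (λ b → ind (I i j) + ind b) (J≡∁I i j))
                                                         (ind-if-not (I i j)))) ⟩
  sumFin m (λ _ → sumFin s (λ _ → 1))
    ≡⟨ sumFin-cong m (λ _ → trans (sumFin-const s 1) (*-identityʳ s)) ⟩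
  sumFin m (λ _ → s)
    ≡⟨ sumFin-const m s ⟩
  m * s ∎
  where open ≡-Reasoning

agreeOn⇒dRT≤ : ∀ {q m s} {x y : Word q m s} (J : PSet m s) → IsAntiIdeal J →
  (∀ i j → J i j ≡ true → x i j ≡ y i j) → dRT≤ x y (m * s ∸ card J)
agreeOn⇒dRT≤ {m = m} {s} {x} {y} J (I , I-ideal , J≡∁I) agree =
  I , I-ideal , differences⊆I , ≤-reflexive card[I]≡m*s∸card[J]
  where
  differences⊆I : ∀ i j → x i j ≢ y i j → I i j ≡ true
  differences⊆I i j x≢y with I i j | J≡∁I i j
  ... | true  | _    = refl
  ... | false | J≡tt = contradiction (agree i j J≡tt) x≢y
  card[I]≡m*s∸card[J] : card I ≡ m * s ∸ card J
  card[I]≡m*s∸card[J] = trans (sym (m+n∸n≡m (card I) (card J)))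
                              (cong (_∸ card J) (card-complement I J J≡∁I))

tops : ∀ {m} s → Subset m → PSet m (suc s)
tops s S i j = lookup S i ∧ does (fromℕ s ≟ j)

tops⁺ : ∀ {m} s (S : Subset m) {i} → i ∈ S → tops s S i (fromℕ s) ≡ true
tops⁺ s S i∈S rewrite []=⇒lookup i∈S = dec-true (fromℕ s ≟ fromℕ s) refl

tops⁻ : ∀ {m} s (S : Subset m) i j → tops s S i j ≡ true → i ∈ S × j ≡ fromℕ s
tops⁻ s S i j tops≡tt with lookup S i in S[i] | fromℕ s ≟ j
... | true | yes top≡j = lookup⇒[]= i S S[i] , sym top≡j

tops-upClosed : ∀ {m} s (S : Subset m) i (j k : Fin (suc s)) →
  tops s S i k ≡ true → k ≤ᶠ j → tops s S i j ≡ true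
tops-upClosed s S i j k tops≡tt k≤j with i∈S , refl ← tops⁻ s S i k tops≡tt
  rewrite ≤ᶠ-antisym (≤fromℕ j) k≤j = tops⁺ s S i∈S

tops-antiIdeal : ∀ {m} s (S : Subset m) → IsAntiIdeal (tops s S)
tops-antiIdeal s S = (λ i j → not (tops s S i j)) , ∁tops-ideal , λ i j → ≡-if-not (tops s S i j)
  where
  ≡-if-not : ∀ b → b ≡ (if not b then false else true)
  ≡-if-not true  = refl
  ≡-if-not false = refl
  ∁tops-ideal : IsIdeal (λ i j → not (tops s S i j))
  ∁tops-ideal i j k ∁tops≡tt k≤j with tops s S i k in tops[k] | tops s S i j in tops[j]
  ... | false | _     = refl
  ... | true  | false =
    contradiction (trans (sym (tops-upClosed s S i j k tops[k] k≤j)) tops[j]) λ ()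
  ∁tops-ideal i j k () k≤j | true | true

card-tops : ∀ {m} s (S : Subset m) → card (tops s S) ≡ ∣ S ∣
card-tops {m} s S = trans (sumFin-cong m (λ i → row (lookup S i))) (sym (∣p∣≡sumFin S))
  where
  row : ∀ b → sumFin (suc s) (λ j → ind (b ∧ does (fromℕ s ≟ j))) ≡ ind b
  row true  = sumFin-ind-≟ (fromℕ s)
  row false = sumFin-zero (suc s)

topRow : ∀ {N v m s} → (Fin N → Word v m (suc s)) → Fin N → Fin m → Fin v
topRow {s = s} A r i = A r i (fromℕ s)

isOCA⇒topRow-isCA : ∀ {N t m s v} (A : Fin N → Word v m (suc s)) →
  IsOCA N t m (suc s) v A → IsCA N t m v (topRow A)
isOCA⇒topRow-isCA {s = s} A oca S ∣S∣≡t f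
  with r , agree ← oca (tops s S) (tops-antiIdeal s S) (trans (card-tops s S) ∣S∣≡t)
                       (λ i _ → f i) =
  r , λ i i∈S → agree i (fromℕ s) (tops⁺ s S i∈S)

codeword : ∀ {Q q v n s N} → (Fin q → Fin v → Fin Q) → (Fin N → Fin n → Fin v) →
  Fin q × Fin N → Word Q n s
codeword enc T (a , r) i _ = enc a (T r i)

code : ∀ {Q q v n s N} → (Fin q → Fin v → Fin Q) → (Fin N → Fin n → Fin v) → List (Word Q n s)
code {q = q} {N = N} enc T = List.tabulate (codeword enc T ∘ remQuot {q} N)

length-code : ∀ {Q q v n s N} (enc : Fin q → Fin v → Fin Q) (T : Fin N → Fin n → Fin v) →
  length (code {s = s} enc T) ≡ q * N
length-code {q = q} {N = N} enc T = length-tabulate (codeword enc T ∘ remQuot {q} N)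

codeword∈code : ∀ {Q q v n s N} (enc : Fin q → Fin v → Fin Q) (T : Fin N → Fin n → Fin v) a r →
  codeword {s = s} enc T (a , r) ∈ₗ code enc T
codeword∈code {q = q} {N = N} enc T a r =
  subst (_∈ₗ code enc T) (cong (codeword enc T) (remQuot-combine a r))
        (∈-tabulate⁺ {f = codeword enc T ∘ remQuot {q} N} (combine a r))

code-isCovering : ∀ {Q q v n N u} s
  (enc : Fin q → Fin v → Fin Q) (decode : Fin Q → Fin q × Fin v) →
  (∀ y → uncurry enc (decode y) ≡ y) → (T : Fin N → Fin n → Fin v) →
  IsCA N (suc u) n v T → u * q < n →
  IsCovering Q n (suc s) (n * suc s ∸ suc u) (code enc T)
code-isCovering {n = n} {u = u} s enc decode enc∘decode T ca u*q<n x
  with a , S , ∣S∣≡1+u , S⊆g⁻¹[a] ←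
         monochromatic-subset u (λ i → proj₁ (decode (x i (fromℕ s)))) u*q<n
  with r , T[r]≡f ← ca S ∣S∣≡1+u (λ i → proj₂ (decode (x i (fromℕ s)))) =
  codeword enc T (a , r) , codeword∈code enc T a r ,
  subst (dRT≤ x (codeword enc T (a , r)))
        (cong (n * suc s ∸_) (trans (card-tops s S) ∣S∣≡1+u))
        (agreeOn⇒dRT≤ (tops s S) (tops-antiIdeal s S) agree)
  where
  agree : ∀ i j → tops s S i j ≡ true → x i j ≡ codeword enc T (a , r) i j
  agree i j tops≡tt with i∈S , refl ← tops⁻ s S i j tops≡tt = begin
    x i (fromℕ s)                        ≡⟨ enc∘decode (x i (fromℕ s)) ⟨
    uncurry enc (decode (x i (fromℕ s))) ≡⟨ cong₂ enc (S⊆g⁻¹[a] i∈S) (sym (T[r]≡f i i∈S)) ⟩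
    enc a (T r i)                        ∎
    where open ≡-Reasoning

covering-bound : ∀ {Q q v n N u K} s
  (enc : Fin q → Fin v → Fin Q) (decode : Fin Q → Fin q × Fin v) →
  (∀ y → uncurry enc (decode y) ≡ y) → (T : Fin N → Fin n → Fin v) →
  IsCA N (suc u) n v T → u * q < n →
  IsK Q n (suc s) (n * suc s ∸ suc u) K → K ≤ q * N
covering-bound s enc decode enc∘decode T ca u*q<n (_ , minimal) =
  minimal _ (code enc T , length-code enc T , code-isCovering s enc decode enc∘decode T ca u*q<n)

extend₃ : ∀ {n} {A : Set} {x y z : Fin n} {a b c : A} →
  (x ≡ y → a ≡ b) → (x ≡ z → a ≡ c) → (y ≡ z → b ≡ c) →
  ∃ λ (F : Fin n → A) → F x ≡ a × F y ≡ b × F z ≡ c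
extend₃ {n} {A} {x} {y} {z} {a} {b} {c} x≡y⇒a≡b x≡z⇒a≡c y≡z⇒b≡c = F , F[x]≡a , F[y]≡b , F[z]≡c
  where
  F : Fin n → A
  F w with x ≟ w | y ≟ w
  ... | yes _ | _     = a
  ... | no _  | yes _ = b
  ... | no _  | no _  = c
  F[x]≡a : F x ≡ a
  F[x]≡a with x ≟ x
  ... | yes _   = refl
  ... | no x≢x = contradiction refl x≢x
  F[y]≡b : F y ≡ b
  F[y]≡b with x ≟ y | y ≟ y
  ... | yes x≡y | _       = x≡y⇒a≡b x≡y
  ... | no _    | yes _   = refl
  ... | no _    | no y≢y = contradiction refl y≢y
  F[z]≡c : F z ≡ c
  F[z]≡c with x ≟ z | y ≟ z
  ... | yes x≡z | _       = x≡z⇒a≡c x≡z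
  ... | no _    | yes y≡z = y≡z⇒b≡c y≡z
  ... | no _    | no _    = refl

extend₂ : ∀ {n} {A : Set} {x y : Fin n} {a b : A} → (x ≡ y → a ≡ b) →
  ∃ λ (F : Fin n → A) → F x ≡ a × F y ≡ b
extend₂ x≡y⇒a≡b with F , F[x]≡a , F[y]≡b , _ ← extend₃ x≡y⇒a≡b x≡y⇒a≡b (λ _ → refl) =
  F , F[x]≡a , F[y]≡b

_⊕_ : Fin 2 → Fin 2 → Fin 2
zero     ⊕ x        = x
suc zero ⊕ zero     = suc zero
suc zero ⊕ suc zero = zero

⊕-involutive : ∀ h x → h ⊕ (h ⊕ x) ≡ x
⊕-involutive zero       x          = refl
⊕-involutive (suc zero) zero       = refl
⊕-involutive (suc zero) (suc zero) = refl

≢-≢⇒⊕≡ : ∀ {h h' x x'} → h ≢ h' → x ≢ x' → h ⊕ x ≡ h' ⊕ x'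
≢-≢⇒⊕≡ {zero}     {zero}     h≢h _   = contradiction refl h≢h
≢-≢⇒⊕≡ {suc zero} {suc zero} h≢h _   = contradiction refl h≢h
≢-≢⇒⊕≡ {zero}     {suc zero} {zero}     {zero}     _ x≢x = contradiction refl x≢x
≢-≢⇒⊕≡ {zero}     {suc zero} {zero}     {suc zero} _ _   = refl
≢-≢⇒⊕≡ {zero}     {suc zero} {suc zero} {zero}     _ _   = refl
≢-≢⇒⊕≡ {zero}     {suc zero} {suc zero} {suc zero} _ x≢x = contradiction refl x≢x
≢-≢⇒⊕≡ {suc zero} {zero}     {zero}     {zero}     _ x≢x = contradiction refl x≢x
≢-≢⇒⊕≡ {suc zero} {zero}     {zero}     {suc zero} _ _   = refl
≢-≢⇒⊕≡ {suc zero} {zero}     {suc zero} {zero}     _ _   = refl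
≢-≢⇒⊕≡ {suc zero} {zero}     {suc zero} {suc zero} _ x≢x = contradiction refl x≢x

Fin2-≢⇒≡⊎≡ : ∀ {h h'} → h ≢ h' → ∀ (h'' : Fin 2) → h'' ≡ h ⊎ h'' ≡ h'
Fin2-≢⇒≡⊎≡ {zero}     {zero}     h≢h _ = contradiction refl h≢h
Fin2-≢⇒≡⊎≡ {suc zero} {suc zero} h≢h _ = contradiction refl h≢h
Fin2-≢⇒≡⊎≡ {zero}     {suc zero} _ zero       = inj₁ refl
Fin2-≢⇒≡⊎≡ {zero}     {suc zero} _ (suc zero) = inj₂ refl
Fin2-≢⇒≡⊎≡ {suc zero} {zero}     _ zero       = inj₂ refl
Fin2-≢⇒≡⊎≡ {suc zero} {zero}     _ (suc zero) = inj₁ refl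

module _ {O C m : ℕ} (A : Fin O → Fin m → Fin 2) (B : Fin C → Fin m → Fin 2) where

  double : Fin (O + C) → Fin 2 × Fin m → Fin 2
  double r (h , i) = [ (λ r' → A r' i) , (λ r' → h ⊕ B r' i) ] (splitAt O r)

  double-↑ˡ : ∀ r h i → double (r ↑ˡ C) (h , i) ≡ A r i
  double-↑ˡ r h i rewrite splitAt-↑ˡ O r C = refl

  double-↑ʳ : ∀ r h i → double (O ↑ʳ r) (h , i) ≡ h ⊕ B r i
  double-↑ʳ r h i rewrite splitAt-↑ʳ O C r = refl

  module _ (A-covers : Covers 3 A) (B-covers : Covers 2 B) (f : Fin 2 × Fin m → Fin 2) where

    Realized : Fin 2 × Fin m → Fin 2 × Fin m → Fin 2 × Fin m → Set
    Realized p₁ p₂ p₃ = ∃ λ r → double r p₁ ≡ f p₁ × double r p₂ ≡ f p₂ × double r p₃ ≡ f p₃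

    Conflict : Fin 2 × Fin m → Fin 2 × Fin m → Set
    Conflict (h , i) (h' , i') = i ≡ i' × f (h , i) ≢ f (h' , i')

    conflict? : ∀ p p' → Conflict p p' ⊎ (proj₂ p ≡ proj₂ p' → f p ≡ f p')
    conflict? (h , i) (h' , i') with i ≟ i' | f (h , i) ≟ f (h' , i')
    ... | yes i≡i' | no  f≢f' = inj₁ (i≡i' , f≢f')
    ... | yes _    | yes f≡f' = inj₂ (λ _ → f≡f')
    ... | no i≢i'  | _        = inj₂ (λ i≡i' → contradiction i≡i' i≢i')

    realized-by-A : ∀ p₁ p₂ p₃ → (proj₂ p₁ ≡ proj₂ p₂ → f p₁ ≡ f p₂) →
      (proj₂ p₁ ≡ proj₂ p₃ → f p₁ ≡ f p₃) → (proj₂ p₂ ≡ proj₂ p₃ → f p₂ ≡ f p₃) →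
      Realized p₁ p₂ p₃
    realized-by-A (h₁ , i₁) (h₂ , i₂) (h₃ , i₃) c₁₂ c₁₃ c₂₃
      with F , F[i₁] , F[i₂] , F[i₃] ← extend₃ c₁₂ c₁₃ c₂₃
      with r , A≡F₁ ∷ A≡F₂ ∷ A≡F₃ ∷ [] ← A-covers F (i₁ ∷ i₂ ∷ i₃ ∷ []) =
      r ↑ˡ C , trans (double-↑ˡ r h₁ i₁) (trans A≡F₁ F[i₁])
             , trans (double-↑ˡ r h₂ i₂) (trans A≡F₂ F[i₂])
             , trans (double-↑ˡ r h₃ i₃) (trans A≡F₃ F[i₃])

    twist : Fin 2 × Fin m → Fin 2
    twist (h , i) = h ⊕ f (h , i)

    conflict⇒twist-constant : ∀ {h₁ h₂ i} → f (h₁ , i) ≢ f (h₂ , i) →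
      ∀ h → twist (h , i) ≡ twist (h₁ , i)
    conflict⇒twist-constant {h₁} {h₂} f₁≢f₂ h with Fin2-≢⇒≡⊎≡ {h₁} {h₂} (λ { refl → f₁≢f₂ refl }) h
    ... | inj₁ refl = refl
    ... | inj₂ refl = sym (≢-≢⇒⊕≡ (λ { refl → f₁≢f₂ refl }) f₁≢f₂)

    B-realizes : ∀ r p → B r (proj₂ p) ≡ twist p → double (O ↑ʳ r) p ≡ f p
    B-realizes r (h , i) B≡twist =
      trans (double-↑ʳ r h i) (trans (cong (h ⊕_) B≡twist) (⊕-involutive h _))

    realized-by-B : ∀ p₁ p₂ p₃ → Conflict p₁ p₂ → Realized p₁ p₂ p₃
    realized-by-B (h₁ , i) (h₂ , .i) (h₃ , i₃) (refl , f₁≢f₂)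
      with G , G[i] , G[i₃] ← extend₂ {x = i} {y = i₃}
                                (λ { refl → sym (conflict⇒twist-constant f₁≢f₂ h₃) })
      with r , B≡G ∷ B≡G₃ ∷ [] ← B-covers G (i ∷ i₃ ∷ []) =
      O ↑ʳ r , B-realizes r (h₁ , i) (trans B≡G G[i])
             , B-realizes r (h₂ , i)
                 (trans (trans B≡G G[i]) (sym (conflict⇒twist-constant f₁≢f₂ h₂)))
             , B-realizes r (h₃ , i₃) (trans B≡G₃ G[i₃])

    realized : ∀ p₁ p₂ p₃ → Realized p₁ p₂ p₃
    realized p₁ p₂ p₃ with conflict? p₁ p₂ | conflict? p₁ p₃ | conflict? p₂ p₃
    ... | inj₁ c₁₂ | _        | _   = realized-by-B p₁ p₂ p₃ c₁₂
    ... | inj₂ _   | inj₁ c₁₃ | _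
      with r , e₁ , e₃ , e₂ ← realized-by-B p₁ p₃ p₂ c₁₃ = r , e₁ , e₂ , e₃
    ... | inj₂ _   | inj₂ _   | inj₁ c₂₃
      with r , e₂ , e₃ , e₁ ← realized-by-B p₂ p₃ p₁ c₂₃ = r , e₁ , e₂ , e₃
    ... | inj₂ c₁₂ | inj₂ c₁₃ | inj₂ c₂₃ = realized-by-A p₁ p₂ p₃ c₁₂ c₁₃ c₂₃

  double-covers : Covers 3 A → Covers 2 B → Covers 3 double
  double-covers A-covers B-covers f (p₁ ∷ p₂ ∷ p₃ ∷ [])
    with r , e₁ , e₂ , e₃ ← realized A-covers B-covers f p₁ p₂ p₃ = r , e₁ ∷ e₂ ∷ e₃ ∷ []

ocan-bound : ∀ {q m s v u K O} → u * q < m →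
  IsK (q * v) m (suc s) (m * suc s ∸ suc u) K → IsOCAN (suc u) m (suc s) v O → K ≤ q * O
ocan-bound {q} {s = s} {v} u*q<m isK ((A , oca) , _) =
  covering-bound s combine (remQuot v) (combine-remQuot {q} v)
                 (topRow A) (isOCA⇒topRow-isCA A oca) u*q<m isK

doubling-bound : ∀ {q m s K O C} → 3 ≤ m → 2 * q < 2 * m →
  IsK (2 * q) (2 * m) (suc s) (2 * m * suc s ∸ 3) K →
  IsOCAN 3 m (suc s) 2 O → IsCAN 2 m 2 C → K ≤ q * (O + C)
doubling-bound {q} {m} {s} {O = O} {C} 3≤m 2q<2m isK ((A , oca) , _) ((B , ca) , _) =
  covering-bound s (λ a b → combine b a) (swap ∘ remQuot q) (combine-remQuot q)
                 doubled doubled-isCA 2q<2m isK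
  where
  doubled : Fin (O + C) → Fin (2 * m) → Fin 2
  doubled r = double (topRow A) B r ∘ remQuot m
  doubled-isCA : IsCA (O + C) 3 (2 * m) 2 doubled
  doubled-isCA =
    covers⇒isCA $ covers-reindex (remQuot m) (λ (h , i) → combine h i) (combine-remQuot m) $
    double-covers (topRow A) B (isCA⇒covers 3≤m (isOCA⇒topRow-isCA A oca))
                               (isCA⇒covers (≤-trans (n≤1+n 2) 3≤m) ca)

corollary5 : ((q m s : ℕ) → 2 ≤ q → 1 ≤ m → 1 ≤ s →
      q < m → m ≤ 2 * q → 2 ≤ s → s ≤ 3 →
      ∀ K O C → IsK (2 * q) (2 * m) s (2 * m * s ∸ 3) K →
      IsOCAN 3 m s 2 O → IsCAN 2 m 2 C →
      K ≤ q * (O + C))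
    ×
    ((q m s v t : ℕ) → 2 ≤ q → 1 ≤ m → 1 ≤ s → 1 ≤ v → 2 ≤ t →
      (t ∸ 1) * q + 1 ≤ m → m ≤ (t ∸ 1) * q * v →
      ∀ K O → IsK (q * v) m s (m * s ∸ t) K →
      IsOCAN t m s v O →
      K ≤ q * O)
corollary5 =
  (λ { _ _ zero _ _ ()
     ; q m (suc s) 2≤q _ _ q<m _ _ _ _ _ _ isK isO isC →
         doubling-bound {q} (≤-trans (s≤s 2≤q) q<m) (*-monoʳ-< 2 q<m) isK isO isC })
  ,
  (λ { _ _ zero _ _ _ _ () ; _ _ _ _ zero _ _ _ _ ()
     ; q m (suc s) v (suc u) _ _ _ _ _ u*q+1≤m _ _ _ isK isO →
         ocan-bound (subst (_≤ m) (+-comm (u * q) 1) u*q+1≤m) isK isO })
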